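{- Let $\mathcal{R}$ be a good base of size $m$ (over $n$-bit strings) and let $d=\frac{n}{4\log m}-1$. Then $$\Pr_{r\leftarrow\mathcal{R}}\Big[\forall \varepsilon<\tfrac12,\ \forall p:\{0,1\}^m\to\mathbb{R} \text{ with } \deg(p)\le d,\ \exists y\in D_r:\ |p(y)-\mathsf{PUR}_r(y)|>\varepsilon\Big]\ge\frac23,$$ where $r$ is drawn uniformly at random from $\mathcal{R}$.
   Context: For $\tau\in\{0,1\}^n$ let $\mathcal{R}^\tau=\{v\in\{0,1\}^n: v_k=0 \text{ for every } k \text{ with } \tau_k=0\}$ (bits where $\tau_k=1$ are free). Let $\mathbf{1}_j\in\{0,1\}^n$ be the string with a 1 in position $j$ and 0 elsewhere. A good base of size $m=n+m'$ is a set of the form $\mathcal{R}=\{\mathbf{1}_1\}\times\cdots\times\{\mathbf{1}_n\}\times\mathcal{R}^{\tau^{(1)}}\times\cdots\times\mathcal{R}^{\tau^{(m')}}$ for some templates $\tau^{(1)},\dots,\tau^{(m')}\in\{0,1\}^n$; an element is an $m$-tuple $r=(r_1,\dots,r_m)$ of $n$-bit strings, and sampling $r$ uniformly from $\mathcal{R}$ means each $r_{n+j}$ is uniform on $\mathcal{R}^{\tau^{(j)}}$, independently. For $r\in\mathcal{R}$ and $x\in\{0,1\}^n$, $\mathcal{Y}(r,x)\in\{0,1\}^m$ is given by $\mathcal{Y}(r,x)_j=\langle r_j,x\rangle \bmod 2$. For fixed $r$, let $D_r=\{\mathcal{Y}(r,x): x\in\{0,1\}^n\}$ and let $\mathsf{PUR}_r:D_r\to\{0,1\}$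 be $\mathsf{PUR}_r(\mathcal{Y}(r,x))=\mathsf{parity}(x)=x_1\oplus\cdots\oplus x_n$ (well defined since the first $n$ coordinates of $\mathcal{Y}(r,x)$ equal $x$). Logarithms are base 2.
   Formalization: The polynomials p have rational coefficients instead of real ones, and ε ranges over the rationals. -}

module Defs where

open import Data.Bool using (Bool; true; false; _∧_; _∨_; _xor_; not; T; T?)
open import Data.Nat using (ℕ; zero; suc; _+_; _*_; _^_; _≤_)
open import Data.Fin using (Fin; _≟_)
open import Data.Vec using (Vec; []; _∷_; map; tabulate; lookup; foldr; zipWith; _++_)
open import Data.List using (List; []; _∷_; length; concatMap; filter; sum)
open import Data.List.Relation.Unary.All using (All)
open import Data.List.Relation.Unary.Unique.Propositional using (Unique)
open import Data.Product using (Σ; ∃; _×_; _,_)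
open import Data.Rational using (ℚ; 0ℚ; 1ℚ; ½; ∣_∣; _-_; _<_)
import Data.Rational as Q
open import Relation.Nullary.Decidable using (⌊_⌋)
open import Relation.Binary.PropositionalEquality using (_≡_)

Bits : ℕ → Set
Bits n = Vec Bool n

inner : ∀ {n} → Bits n → Bits n → Bool
inner r x = foldr _ _xor_ false (zipWith _∧_ r x)

parity : ∀ {n} → Bits n → Bool
parity x = foldr _ _xor_ false x

unit : ∀ {n} → Fin n → Bits n
unit j = tabulate (λ k → ⌊ k ≟ j ⌋)

-- v ∈ R^τ  (boolean test: for every k, τ_k = 0 implies v_k = 0)
inTemplateᵇ : ∀ {n} → Bits n → Bits n → Bool
inTemplateᵇ τ v = foldr _ _∧_ true (zipWith (λ t b → t ∨ not b) τ v)

-- the free part (r_{n+1},...,r_{n+m'}) lies in R^{τ(1)} × ... × R^{τ(m')}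
inBaseᵇ : ∀ {n m'} → Vec (Bits n) m' → Vec (Bits n) m' → Bool
inBaseᵇ τs rs = foldr _ _∧_ true (zipWith inTemplateᵇ τs rs)

Y : ∀ {n m'} → Vec (Bits n) m' → Bits n → Bits (n + m')
Y {n} rs x = map (λ r → inner r x) (tabulate unit ++ rs)

allVecs : ∀ {A : Set} → List A → (k : ℕ) → List (Vec A k)
allVecs xs zero = [] ∷ []
allVecs xs (suc k) = concatMap (λ a → Data.List.map (a ∷_) (allVecs xs k)) xs

baseSize : ∀ {n m'} → Vec (Bits n) m' → ℕ
baseSize {n} {m'} τs =
  length (filter (λ rs → T? (inBaseᵇ τs rs))
                 (allVecs (allVecs (true ∷ false ∷ []) n) m'))

toℚ : Bool → ℚ
toℚ true = 1ℚ
toℚ false = 0ℚ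

popcount : ∀ {m} → Bits m → ℕ
popcount xs = foldr _ (λ b k → (if b then 1 else 0) + k) 0 xs
  where open import Data.Bool using (if_then_else_)

-- multilinear polynomial over ℚ on m variables: list of (coefficient, monomial support)
Poly : ℕ → Set
Poly m = List (ℚ × Bits m)

monomial : ∀ {m} → Bits m → Bits m → ℚ
monomial S y = foldr _ Q._*_ 1ℚ (zipWith (λ s b → if s then toℚ b else 1ℚ) S y)
  where open import Data.Bool using (if_then_else_)

eval : ∀ {m} → Poly m → Bits m → ℚ
eval [] y = 0ℚ
eval ((c , S) ∷ p) y = c Q.* monomial S y Q.+ eval p y

-- deg(p) ≤ n/(4 log m) − 1, i.e. every monomial degree k satisfies
-- 4 (k+1) log m ≤ n, i.e. m^(4(k+1)) ≤ 2^n   (exact, for m ≥ 2)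
DegOK : (n m : ℕ) → Poly m → Set
DegOK n m p = All (λ { (c , S) → m ^ (4 * suc (popcount S)) ≤ 2 ^ n }) p

Event : ∀ {n m'} → Vec (Bits n) m' → Set
Event {n} {m'} rs =
  ∀ (ε : ℚ) → ε < ½ → ∀ (p : Poly (n + m')) → DegOK n (n + m') p →
  ∃ λ (x : Bits n) → ε < ∣ eval p (Y rs x) - toℚ (parity x) ∣

-- Pr_{r ← R}[Event r] ≥ 2/3 : a duplicate-free list of good-base elements
-- satisfying the event, of size at least (2/3)|R|
ProbAtLeastTwoThirds : ∀ {n m'} → Vec (Bits n) m' → Set
ProbAtLeastTwoThirds {n} {m'} τs =
  Σ (List (Vec (Bits n) m')) λ L →
    Unique L × All (λ rs → T (inBaseᵇ τs rs) × Event rs) L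
    × 2 * baseSize τs ≤ 3 * length L

-- Write v₁, …, v_m for the rows of r (the unit vectors 1_j, then r_{n+1}, …, r_{n+m'}), so that
-- Y(r,x)_j = ⟨v_j, x⟩. Suppose every monomial S of p admits a z of odd parity orthogonal to all v_j
-- with j ∈ S. Then each monomial of p ∘ Y(r,·) is invariant under x ↦ x ⊕ z while the parity of x
-- flips, so p ∘ Y(r,·) has zero correlation with (−1)^parity, whereas a function within ε < 1/2 of
-- parity has negative correlation. Over 𝔽₂ such a z fails to exist only if the all-ones vector is the
-- sum of at most |S| rows, so r can only fail if the all-ones vector is the sum of the rows in some T
-- with m^{4(|T|+1)} ≤ 2ⁿ.
-- Split T into unit rows U and random rows F; then the random rows in F must sum to ∁U. This has
-- probability at most 2^{|U|−n}: the fibres of r ↦ Σ_{j∈F} r_j over the points ∁U ∩ a all have the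
-- size of the fibre over ∁U (translate by a masked copy of an r in that fibre), and each r lies in
-- the fibre over ∁U ∩ a for at most 2^{|U|} of the 2ⁿ masks a. With a = m⁴, each admissible T has
-- 2^{|T|} ≤ 2ⁿ 2^{|T|} a^{m−|T|} / a^{m+1}, and these bounds sum to 2ⁿ (2 + a)^m / a^{m+1} ≤ 2ⁿ/3, so
-- by the union bound r fails with probability at most 1/3.
{-# OPTIONS --safe #-}
module Submission where

open import Defs
open import Algebra.Bundles using (CommutativeMonoid; CommutativeRing)
open import Algebra.Core using (Op₂)
import Algebra.Properties.CommutativeSemigroup as CommutativeSemigroupProperties
open import Algebra.Structures using (IsCommutativeMonoid; IsSemiring; IsCommutativeRing)
open import Data.Bool using (Bool; true; false; _∧_; _xor_; not; T; T?; if_then_else_)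
import Data.Bool as Bool
open import Data.Bool.Properties
  using (xor-∧-commutativeRing; xor-comm; xor-assoc; xor-identityˡ; xor-identityʳ; xor-same; not-involutive;
         ∧-distribˡ-xor; ∧-distribʳ-xor; ∧-identityˡ; ∧-zeroˡ; ∧-zeroʳ; T-∧)
open import Data.Empty using (⊥-elim)
open import Data.Fin using (Fin) renaming (zero to fzero; suc to fsuc)
import Data.Fin as Fin
open import Data.List using (List; []; _∷_; concatMap; cartesianProductWith; filter; length)
import Data.List as List
open import Data.List.Membership.Propositional using (_∈_; lose)
open import Data.List.Membership.Propositional.Properties using (∈-cartesianProductWith⁺)
open import Data.List.Relation.Unary.All using (All; []; _∷_)
import Data.List.Relation.Unary.All as All
open import Data.List.Relation.Unary.All.Properties using (¬Any⇒All¬; all-filter)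
import Data.List.Relation.Unary.All.Properties as All
open import Data.List.Relation.Unary.AllPairs using ([]; _∷_)
open import Data.List.Relation.Unary.Any using (Any; here; there; any?; satisfied)
open import Data.List.Relation.Unary.Unique.Propositional using (Unique)
import Data.List.Relation.Unary.Unique.Propositional.Properties as Unique
open import Data.Nat using (ℕ; zero; suc; _+_; _*_; _^_; _≤_; z≤n; s≤s; NonZero; >-nonZero)
import Data.Nat.Properties as ℕ
open import Data.Nat.Tactic.RingSolver using (solve-∀)
open import Data.Product using (∃; _×_; _,_; proj₂)
open import Data.Rational as ℚ using (ℚ; 0ℚ; 1ℚ; ½; -_; ∣_∣)
import Data.Rational.Properties as ℚ
open import Data.Sum using (_⊎_; inj₁; inj₂)
open import Data.Unit using (⊤; tt)
open import Data.Vec using (Vec; []; _∷_; zipWith; replicate; tabulate; _++_)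
import Data.Vec as Vec
import Data.Vec.Properties as Vec
open import Function using (_∘_)
open import Function.Bundles using (_⇔_; mk⇔; Equivalence)
open import Level using (0ℓ)
open import Relation.Binary.Definitions using (DecidableEquality)
open import Relation.Binary.PropositionalEquality
open import Relation.Binary.PropositionalEquality.Algebra using (isMagma)
open import Relation.Nullary using (Dec; yes; no; ¬_)
open import Relation.Nullary.Decidable using (⌊_⌋; does; dec⇒maybe; _×-dec_; ¬?; does-⇔)
open import Relation.Unary using (Decidable)
import Tactic.RingSolver as RingSolver
open import Tactic.RingSolver.Core.AlmostCommutativeRing using (AlmostCommutativeRing; fromCommutativeRing)

-- Bit vectors as an 𝔽₂-vector space

infixl 6 _⊕_
infixl 7 _∩_
infix 4 _≟_

_⊕_ : ∀ {n} → Bits n → Bits n → Bits n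
_⊕_ = zipWith _xor_

_∩_ : ∀ {n} → Bits n → Bits n → Bits n
_∩_ = zipWith _∧_

zeros ones : ∀ {n} → Bits n
zeros = replicate _ false
ones = replicate _ true

∁ : ∀ {n} → Bits n → Bits n
∁ = Vec.map not

_≟_ : ∀ {n} → DecidableEquality (Bits n)
_≟_ = Vec.≡-dec Bool._≟_

⊕-isCommutativeMonoid : ∀ n → IsCommutativeMonoid _≡_ (_⊕_ {n}) zeros
⊕-isCommutativeMonoid n = record
  { isMonoid = record
    { isSemigroup = record { isMagma = isMagma _⊕_ ; assoc = Vec.zipWith-assoc xor-assoc }
    ; identity = Vec.zipWith-identityˡ xor-identityˡ , Vec.zipWith-identityʳ xor-identityʳ
    }
  ; comm = Vec.zipWith-comm xor-comm
  }

⊕-commutativeMonoid : ℕ → CommutativeMonoid 0ℓ 0ℓ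
⊕-commutativeMonoid n = record { isCommutativeMonoid = ⊕-isCommutativeMonoid n }

module ⊕ {n : ℕ} where
  open IsCommutativeMonoid (⊕-isCommutativeMonoid n) public
    using (assoc; comm; identityˡ; identityʳ)
  open CommutativeSemigroupProperties (CommutativeMonoid.commutativeSemigroup (⊕-commutativeMonoid n)) public
    using (interchange)

xor-interchange : ∀ a b c d → (a xor b) xor (c xor d) ≡ (a xor c) xor (b xor d)
xor-interchange = CommutativeSemigroupProperties.interchange
  (CommutativeRing.+-commutativeSemigroup xor-∧-commutativeRing)

⊕-self : ∀ {n} (u : Bits n) → u ⊕ u ≡ zeros
⊕-self [] = refl
⊕-self (b ∷ u) = cong₂ _∷_ (xor-same b) (⊕-self u)

⊕-cancelˡ : ∀ {n} (v w : Bits n) → v ⊕ (v ⊕ w) ≡ w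
⊕-cancelˡ v w = begin
  v ⊕ (v ⊕ w)  ≡⟨ ⊕.assoc v v w ⟨
  (v ⊕ v) ⊕ w  ≡⟨ cong (_⊕ w) (⊕-self v) ⟩
  zeros ⊕ w    ≡⟨ ⊕.identityˡ w ⟩
  w            ∎
  where open ≡-Reasoning

⊕-cancelʳ : ∀ {n} (u d : Bits n) → (u ⊕ d) ⊕ d ≡ u
⊕-cancelʳ u d = begin
  (u ⊕ d) ⊕ d  ≡⟨ ⊕.assoc u d d ⟩
  u ⊕ (d ⊕ d)  ≡⟨ cong (u ⊕_) (⊕-self d) ⟩
  u ⊕ zeros    ≡⟨ ⊕.identityʳ u ⟩
  u            ∎
  where open ≡-Reasoning

⊕-move : ∀ {n} {u d c : Bits n} → (u ⊕ d ≡ c) ⇔ (u ≡ c ⊕ d)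
⊕-move {u = u} {d} {c} = mk⇔
  (λ u⊕d≡c → trans (sym (⊕-cancelʳ u d)) (cong (_⊕ d) u⊕d≡c))
  (λ u≡c⊕d → trans (cong (_⊕ d) u≡c⊕d) (⊕-cancelʳ c d))

ones-⊕ : ∀ {n} (u : Bits n) → ones ⊕ u ≡ ∁ u
ones-⊕ u = trans (⊕.comm ones u)
  (trans (Vec.zipWith-replicate₂ _xor_ u true) (Vec.map-cong (λ b → xor-comm b true) u))

∩-distribˡ-⊕ : ∀ {n} (w u v : Bits n) → w ∩ (u ⊕ v) ≡ (w ∩ u) ⊕ (w ∩ v)
∩-distribˡ-⊕ = Vec.zipWith-distribˡ ∧-distribˡ-xor

∩-distribʳ-⊕ : ∀ {n} (w u v : Bits n) → (u ⊕ v) ∩ w ≡ (u ∩ w) ⊕ (v ∩ w)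
∩-distribʳ-⊕ = Vec.zipWith-distribʳ ∧-distribʳ-xor

⊕-∩-∁ : ∀ {n} (c a : Bits n) → c ⊕ (c ∩ ∁ a) ≡ c ∩ a
⊕-∩-∁ [] [] = refl
⊕-∩-∁ (true ∷ c) (b ∷ a) = cong₂ _∷_ (not-involutive b) (⊕-∩-∁ c a)
⊕-∩-∁ (false ∷ c) (b ∷ a) = cong (false ∷_) (⊕-∩-∁ c a)

parity-⊕ : ∀ {n} (u v : Bits n) → parity (u ⊕ v) ≡ parity u xor parity v
parity-⊕ [] [] = refl
parity-⊕ (a ∷ u) (b ∷ v) = trans (cong ((a xor b) xor_) (parity-⊕ u v)) (xor-interchange a b _ _)

parity-zeros : ∀ n → parity (zeros {n}) ≡ false
parity-zeros zero = refl
parity-zeros (suc n) = parity-zeros n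

inner-⊕ʳ : ∀ {n} (r x z : Bits n) → inner r (x ⊕ z) ≡ inner r x xor inner r z
inner-⊕ʳ r x z = trans (cong parity (∩-distribˡ-⊕ r x z)) (parity-⊕ (r ∩ x) (r ∩ z))

inner-⊕ˡ : ∀ {n} (r s z : Bits n) → inner (r ⊕ s) z ≡ inner r z xor inner s z
inner-⊕ˡ r s z = trans (cong parity (∩-distribʳ-⊕ z r s)) (parity-⊕ (r ∩ z) (s ∩ z))

inner-onesˡ : ∀ {n} (z : Bits n) → inner ones z ≡ parity z
inner-onesˡ z = cong parity (Vec.zipWith-identityˡ ∧-identityˡ z)

inner-zerosʳ : ∀ {n} (w : Bits n) → inner w zeros ≡ false
inner-zerosʳ {n} w = trans (cong parity (Vec.zipWith-zeroʳ ∧-zeroʳ w)) (parity-zeros n)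

-- Linear combinations and duality

combination : ∀ {n k} → Bits k → Vec (Bits n) k → Bits n
combination [] [] = zeros
combination (true ∷ T) (v ∷ vs) = v ⊕ combination T vs
combination (false ∷ T) (v ∷ vs) = combination T vs

combination-⊕ : ∀ {n k} (T : Bits k) (vs ws : Vec (Bits n) k) →
  combination T (zipWith _⊕_ vs ws) ≡ combination T vs ⊕ combination T ws
combination-⊕ [] [] [] = sym (⊕.identityˡ zeros)
combination-⊕ (true ∷ T) (v ∷ vs) (w ∷ ws) =
  trans (cong ((v ⊕ w) ⊕_) (combination-⊕ T vs ws)) (⊕.interchange v w _ _)
combination-⊕ (false ∷ T) (v ∷ vs) (w ∷ ws) = combination-⊕ T vs ws

combination-∩ : ∀ {n k} (T : Bits k) (vs : Vec (Bits n) k) (b : Bits n) →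
  combination T (Vec.map (_∩ b) vs) ≡ combination T vs ∩ b
combination-∩ [] [] b = sym (Vec.zipWith-zeroˡ ∧-zeroˡ b)
combination-∩ (true ∷ T) (v ∷ vs) b =
  trans (cong ((v ∩ b) ⊕_) (combination-∩ T vs b)) (sym (∩-distribʳ-⊕ b v (combination T vs)))
combination-∩ (false ∷ T) (v ∷ vs) b = combination-∩ T vs b

combination-++ : ∀ {n k l} (A : Bits k) (B : Bits l) (vs : Vec (Bits n) k) (ws : Vec (Bits n) l) →
  combination (A ++ B) (vs ++ ws) ≡ combination A vs ⊕ combination B ws
combination-++ [] B [] ws = sym (⊕.identityˡ (combination B ws))
combination-++ (true ∷ A) B (v ∷ vs) ws =
  trans (cong (v ⊕_) (combination-++ A B vs ws)) (sym (⊕.assoc v (combination A vs) (combination B ws)))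
combination-++ (false ∷ A) B (v ∷ vs) ws = combination-++ A B vs ws

combination-false∷ : ∀ {n k} (T : Bits k) (vs : Vec (Bits n) k) →
  combination T (Vec.map (false ∷_) vs) ≡ false ∷ combination T vs
combination-false∷ [] [] = refl
combination-false∷ (true ∷ T) (v ∷ vs) = cong ((false ∷ v) ⊕_) (combination-false∷ T vs)
combination-false∷ (false ∷ T) (v ∷ vs) = combination-false∷ T vs

unit-zero : ∀ {n} → unit {suc n} fzero ≡ true ∷ zeros
unit-zero {n} = cong (true ∷_) (trans (Vec.tabulate-allFin (λ _ → false)) (Vec.map-const (Vec.allFin n) false))

unit-suc : ∀ {n} (j : Fin n) → unit (fsuc j) ≡ false ∷ unit j
unit-suc j = cong (false ∷_) (Vec.tabulate-cong ⌊suc≟suc⌋)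
  where
    ⌊suc≟suc⌋ : ∀ k → ⌊ fsuc k Fin.≟ fsuc j ⌋ ≡ ⌊ k Fin.≟ j ⌋
    ⌊suc≟suc⌋ k with k Fin.≟ j
    ... | yes _ = refl
    ... | no _ = refl

combination-shifted-units : ∀ {n} (U : Bits n) →
  combination U (tabulate (unit ∘ fsuc)) ≡ false ∷ combination U (tabulate unit)
combination-shifted-units U = trans
  (cong (combination U) (trans (Vec.tabulate-cong unit-suc) (Vec.tabulate-∘ (false ∷_) unit)))
  (combination-false∷ U (tabulate unit))

combination-units : ∀ {n} (U : Bits n) → combination U (tabulate unit) ≡ U
combination-units [] = refl
combination-units (true ∷ U) = begin
  unit fzero ⊕ combination U (tabulate (unit ∘ fsuc))      ≡⟨ cong₂ _⊕_ unit-zero (combination-shifted-units U) ⟩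
  (true ∷ zeros) ⊕ (false ∷ combination U (tabulate unit)) ≡⟨ cong (true ∷_) (⊕.identityˡ _) ⟩
  true ∷ combination U (tabulate unit)                     ≡⟨ cong (true ∷_) (combination-units U) ⟩
  true ∷ U                                                 ∎
  where open ≡-Reasoning
combination-units (false ∷ U) =
  trans (combination-shifted-units U) (cong (false ∷_) (combination-units U))

Orthogonal : ∀ {n k} → Bits k → Vec (Bits n) k → Bits n → Set
Orthogonal [] [] z = ⊤
Orthogonal (true ∷ S) (v ∷ vs) z = inner v z ≡ false × Orthogonal S vs z
Orthogonal (false ∷ S) (v ∷ vs) z = Orthogonal S vs z

orthogonal-⊕ : ∀ {n k} (S : Bits k) (vs : Vec (Bits n) k) {z₁ z₂} →
  Orthogonal S vs z₁ → Orthogonal S vs z₂ → Orthogonal S vs (z₁ ⊕ z₂)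
orthogonal-⊕ [] [] _ _ = tt
orthogonal-⊕ (true ∷ S) (v ∷ vs) {z₁} {z₂} (vz₁ , o₁) (vz₂ , o₂) =
  trans (inner-⊕ʳ v z₁ z₂) (cong₂ _xor_ vz₁ vz₂) , orthogonal-⊕ S vs o₁ o₂
orthogonal-⊕ (false ∷ S) (v ∷ vs) o₁ o₂ = orthogonal-⊕ S vs o₁ o₂

zeros-or-detectable : ∀ {n} (w : Bits n) → w ≡ zeros ⊎ ∃ λ z → inner w z ≡ true
zeros-or-detectable [] = inj₁ refl
zeros-or-detectable (true ∷ w) = inj₂ (true ∷ zeros , cong not (inner-zerosʳ w))
zeros-or-detectable (false ∷ w) with zeros-or-detectable w
... | inj₁ w≡0 = inj₁ (cong (false ∷_) w≡0)
... | inj₂ (z , wz) = inj₂ (false ∷ z , wz)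

xor≡true⇒≡not : ∀ a b → a xor b ≡ true → b ≡ not a
xor≡true⇒≡not true false _ = refl
xor≡true⇒≡not false true _ = refl

-- If neither z₁ nor z₂ is orthogonal to v, then z₁ ⊕ z₂ is.
orthogonal-witness : ∀ {n} (P : Bits n → Set) → (∀ {a b} → P a → P b → P (a ⊕ b)) →
  (v w : Bits n) {z₁ z₂ : Bits n} → P z₁ → P z₂ →
  inner w z₁ ≡ true → inner w z₂ ≡ not (inner v z₂) →
  ∃ λ z → P z × inner v z ≡ false × inner w z ≡ true
orthogonal-witness P P-⊕ v w {z₁} {z₂} p₁ p₂ wz₁ wz₂ with inner v z₁ in vz₁ | inner v z₂ in vz₂
... | false | _ = z₁ , p₁ , vz₁ , wz₁
... | true | false = z₂ , p₂ , vz₂ , wz₂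
... | true | true = z₁ ⊕ z₂ , P-⊕ p₁ p₂ ,
  trans (inner-⊕ʳ v z₁ z₂) (cong₂ _xor_ vz₁ vz₂) , trans (inner-⊕ʳ w z₁ z₂) (cong₂ _xor_ wz₁ wz₂)

combination-or-separated : ∀ {n k} (S : Bits k) (vs : Vec (Bits n) k) (w : Bits n) →
  (∃ λ T → popcount T ≤ popcount S × combination T vs ≡ w) ⊎
  (∃ λ z → Orthogonal S vs z × inner w z ≡ true)
combination-or-separated [] [] w with zeros-or-detectable w
... | inj₁ w≡0 = inj₁ ([] , z≤n , sym w≡0)
... | inj₂ (z , wz) = inj₂ (z , tt , wz)
combination-or-separated (false ∷ S) (v ∷ vs) w with combination-or-separated S vs w
... | inj₁ (T , T≤S , T↦w) = inj₁ (false ∷ T , T≤S , T↦w)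
... | inj₂ separated = inj₂ separated
combination-or-separated (true ∷ S) (v ∷ vs) w
  with combination-or-separated S vs w | combination-or-separated S vs (v ⊕ w)
... | inj₁ (T , T≤S , T↦w) | _ = inj₁ (false ∷ T , ℕ.m≤n⇒m≤1+n T≤S , T↦w)
... | inj₂ _ | inj₁ (T , T≤S , T↦v⊕w) =
  inj₁ (true ∷ T , s≤s T≤S , trans (cong (v ⊕_) T↦v⊕w) (⊕-cancelˡ v w))
... | inj₂ (z₁ , o₁ , wz₁) | inj₂ (z₂ , o₂ , [v⊕w]z₂)
  with orthogonal-witness (Orthogonal S vs) (orthogonal-⊕ S vs) v w o₁ o₂ wz₁
         (xor≡true⇒≡not _ _ (trans (sym (inner-⊕ˡ v w z₂)) [v⊕w]z₂))
...   | z , o , vz , wz = inj₂ (z , (vz , o) , wz)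

-- Enumerations and finite sums

bools : List Bool
bools = true ∷ false ∷ []

bools-unique : Unique bools
bools-unique = ((λ ()) ∷ []) ∷ [] ∷ []

bools-complete : ∀ b → b ∈ bools
bools-complete true = here refl
bools-complete false = there (here refl)

bitStrings : ∀ n → List (Bits n)
bitStrings = allVecs bools

tuples : ∀ n m' → List (Vec (Bits n) m')
tuples n m' = allVecs (bitStrings n) m'

concatMap-map≡cartesianProductWith : ∀ {A B C : Set} (f : A → B → C) (xs : List A) (ys : List B) →
  concatMap (λ x → List.map (f x) ys) xs ≡ cartesianProductWith f xs ys
concatMap-map≡cartesianProductWith f [] ys = refl
concatMap-map≡cartesianProductWith f (x ∷ xs) ys =
  cong (List.map (f x) ys List.++_) (concatMap-map≡cartesianProductWith f xs ys)

allVecs-suc : ∀ {A : Set} (xs : List A) k → allVecs xs (suc k) ≡ cartesianProductWith _∷_ xs (allVecs xs k)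
allVecs-suc xs k = concatMap-map≡cartesianProductWith _∷_ xs (allVecs xs k)

allVecs-unique : ∀ {A : Set} {xs : List A} → Unique xs → ∀ k → Unique (allVecs xs k)
allVecs-unique u zero = [] ∷ []
allVecs-unique {xs = xs} u (suc k) = subst Unique (sym (allVecs-suc xs k))
  (Unique.cartesianProductWith⁺ _∷_ Vec.∷-injective u (allVecs-unique u k))

∈-allVecs : ∀ {A : Set} {xs : List A} → (∀ a → a ∈ xs) → ∀ {k} (v : Vec A k) → v ∈ allVecs xs k
∈-allVecs complete [] = here refl
∈-allVecs {xs = xs} complete {suc k} (a ∷ v) = subst (a ∷ v ∈_) (sym (allVecs-suc xs k))
  (∈-cartesianProductWith⁺ _∷_ (complete a) (∈-allVecs complete v))

∈-bitStrings : ∀ {n} (x : Bits n) → x ∈ bitStrings n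
∈-bitStrings = ∈-allVecs bools-complete

module FiniteSum {C : Set} {_+_ _*_ : Op₂ C} {0# 1# : C} (isSemiring : IsSemiring _≡_ _+_ _*_ 0# 1#) where

  open IsSemiring isSemiring using (+-assoc; +-comm; +-identityˡ; +-isCommutativeMonoid; distribˡ; zeroʳ)

  +-commutativeMonoid : CommutativeMonoid 0ℓ 0ℓ
  +-commutativeMonoid = record { isCommutativeMonoid = +-isCommutativeMonoid }

  open CommutativeSemigroupProperties (CommutativeMonoid.commutativeSemigroup +-commutativeMonoid)
    using (interchange)

  ∑ : ∀ {A : Set} → List A → (A → C) → C
  ∑ [] f = 0#
  ∑ (x ∷ xs) f = f x + ∑ xs f

  infix 5 ∑
  syntax ∑ xs (λ x → e) = ∑[ x ← xs ] e

  ∑-cong : ∀ {A : Set} (xs : List A) {f g : A → C} → (∀ x → f x ≡ g x) → ∑ xs f ≡ ∑ xs g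
  ∑-cong [] f≗g = refl
  ∑-cong (x ∷ xs) f≗g = cong₂ _+_ (f≗g x) (∑-cong xs f≗g)

  ∑-++ : ∀ {A : Set} (xs ys : List A) (f : A → C) → ∑ (xs List.++ ys) f ≡ ∑ xs f + ∑ ys f
  ∑-++ [] ys f = sym (+-identityˡ _)
  ∑-++ (x ∷ xs) ys f = trans (cong (f x +_) (∑-++ xs ys f)) (sym (+-assoc _ _ _))

  ∑-map : ∀ {A B : Set} (g : A → B) (xs : List A) (f : B → C) → ∑ (List.map g xs) f ≡ ∑[ x ← xs ] f (g x)
  ∑-map g [] f = refl
  ∑-map g (x ∷ xs) f = cong (f (g x) +_) (∑-map g xs f)

  ∑-cartesianProductWith : ∀ {A B D : Set} (h : A → B → D) (xs : List A) (ys : List B) (f : D → C) →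
    ∑ (cartesianProductWith h xs ys) f ≡ ∑[ x ← xs ] ∑[ y ← ys ] f (h x y)
  ∑-cartesianProductWith h [] ys f = refl
  ∑-cartesianProductWith h (x ∷ xs) ys f = begin
    ∑ (List.map (h x) ys List.++ cartesianProductWith h xs ys) f
      ≡⟨ ∑-++ (List.map (h x) ys) _ f ⟩
    ∑ (List.map (h x) ys) f + ∑ (cartesianProductWith h xs ys) f
      ≡⟨ cong₂ _+_ (∑-map (h x) ys f) (∑-cartesianProductWith h xs ys f) ⟩
    (∑[ y ← ys ] f (h x y)) + (∑[ x′ ← xs ] ∑[ y ← ys ] f (h x′ y)) ∎
    where open ≡-Reasoning

  ∑-allVecs-suc : ∀ {A : Set} (xs : List A) k (f : Vec A (suc k) → C) →
    ∑ (allVecs xs (suc k)) f ≡ ∑[ a ← xs ] ∑[ v ← allVecs xs k ] f (a ∷ v)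
  ∑-allVecs-suc xs k f = trans (cong (λ l → ∑ l f) (allVecs-suc xs k)) (∑-cartesianProductWith _∷_ xs _ f)

  ∑-+ : ∀ {A : Set} (xs : List A) (f g : A → C) → ∑[ x ← xs ] (f x + g x) ≡ ∑ xs f + ∑ xs g
  ∑-+ [] f g = sym (+-identityˡ 0#)
  ∑-+ (x ∷ xs) f g = trans (cong ((f x + g x) +_) (∑-+ xs f g)) (interchange _ _ _ _)

  ∑-0 : ∀ {A : Set} (xs : List A) → ∑[ x ← xs ] 0# ≡ 0#
  ∑-0 [] = refl
  ∑-0 (x ∷ xs) = trans (+-identityˡ _) (∑-0 xs)

  ∑-*ˡ : ∀ {A : Set} (c : C) (xs : List A) (f : A → C) → ∑[ x ← xs ] (c * f x) ≡ c * ∑ xs f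
  ∑-*ˡ c [] f = sym (zeroʳ c)
  ∑-*ˡ c (x ∷ xs) f = trans (cong ((c * f x) +_) (∑-*ˡ c xs f)) (sym (distribˡ c (f x) (∑ xs f)))

  ∑-comm : ∀ {A B : Set} (xs : List A) (ys : List B) (f : A → B → C) →
    ∑[ x ← xs ] ∑[ y ← ys ] f x y ≡ ∑[ y ← ys ] ∑[ x ← xs ] f x y
  ∑-comm [] ys f = sym (∑-0 ys)
  ∑-comm (x ∷ xs) ys f =
    trans (cong (∑ ys (f x) +_) (∑-comm xs ys f)) (sym (∑-+ ys (f x) (λ y → ∑[ x′ ← xs ] f x′ y)))

  TranslationInvariant : ∀ {A : Set} → Op₂ A → List A → Set
  TranslationInvariant _∙_ xs = ∀ (f : _ → C) d → ∑[ x ← xs ] f (x ∙ d) ≡ ∑ xs f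

  allVecs-translationInvariant : ∀ {A : Set} {_∙_ : Op₂ A} {xs : List A} → TranslationInvariant _∙_ xs →
    ∀ k → TranslationInvariant (zipWith {n = k} _∙_) (allVecs xs k)
  allVecs-translationInvariant invariant zero f [] = refl
  allVecs-translationInvariant {_∙_ = _∙_} {xs} invariant (suc k) f (d ∷ ds) = begin
    ∑[ v ← allVecs xs (suc k) ] f (zipWith _∙_ v (d ∷ ds))
      ≡⟨ ∑-allVecs-suc xs k _ ⟩
    ∑[ a ← xs ] ∑[ v ← allVecs xs k ] f ((a ∙ d) ∷ zipWith _∙_ v ds)
      ≡⟨ ∑-cong xs (λ a → allVecs-translationInvariant invariant k (λ v → f ((a ∙ d) ∷ v)) ds) ⟩
    ∑[ a ← xs ] ∑[ v ← allVecs xs k ] f ((a ∙ d) ∷ v)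
      ≡⟨ invariant (λ a → ∑[ v ← allVecs xs k ] f (a ∷ v)) d ⟩
    ∑[ a ← xs ] ∑[ v ← allVecs xs k ] f (a ∷ v)
      ≡⟨ ∑-allVecs-suc xs k f ⟨
    ∑ (allVecs xs (suc k)) f ∎
    where open ≡-Reasoning

  bools-translationInvariant : TranslationInvariant _xor_ bools
  bools-translationInvariant f false = refl
  bools-translationInvariant f true = begin
    f false + (f true + 0#)  ≡⟨ +-assoc _ _ _ ⟨
    (f false + f true) + 0#  ≡⟨ cong (_+ 0#) (+-comm _ _) ⟩
    (f true + f false) + 0#  ≡⟨ +-assoc _ _ _ ⟩
    f true + (f false + 0#)  ∎
    where open ≡-Reasoning

  bitStrings-translationInvariant : ∀ n → TranslationInvariant _⊕_ (bitStrings n)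
  bitStrings-translationInvariant = allVecs-translationInvariant bools-translationInvariant

module ℚ∑ = FiniteSum (IsCommutativeRing.isSemiring ℚ.+-*-isCommutativeRing)
module ℕ∑ = FiniteSum ℕ.+-*-isSemiring

-- Correlation with parity

ℚ-ring : AlmostCommutativeRing 0ℓ 0ℓ
ℚ-ring = fromCommutativeRing ℚ.+-*-commutativeRing (λ q → dec⇒maybe (0ℚ ℚ.≟ q))

p≤∣p∣ : ∀ p → p ℚ.≤ ∣ p ∣
p≤∣p∣ p with ℚ.≤-total 0ℚ p
... | inj₁ 0≤p = ℚ.≤-reflexive (sym (ℚ.0≤p⇒∣p∣≡p 0≤p))
... | inj₂ p≤0 = ℚ.≤-trans p≤0 (ℚ.0≤∣p∣ p)

p≡-p⇒p≡0 : ∀ p → p ≡ - p → p ≡ 0ℚ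
p≡-p⇒p≡0 p p≡-p with ℚ.≤-total 0ℚ p
... | inj₁ 0≤p = ℚ.≤-antisym (ℚ.≤-trans (ℚ.≤-reflexive p≡-p) (ℚ.neg-antimono-≤ 0≤p)) 0≤p
... | inj₂ p≤0 = ℚ.≤-antisym p≤0 (ℚ.≤-trans (ℚ.neg-antimono-≤ p≤0) (ℚ.≤-reflexive (sym p≡-p)))

signed : Bool → ℚ → ℚ
signed false q = q
signed true q = - q

signed-not : ∀ b q → signed (not b) q ≡ - signed b q
signed-not false q = refl
signed-not true q = sym (neg-involutive q)
  where
    neg-involutive : ∀ q → - (- q) ≡ q
    neg-involutive = RingSolver.solve-∀ ℚ-ring

signed-linear : ∀ b c m r → signed b (c ℚ.* m ℚ.+ r) ≡ c ℚ.* signed b m ℚ.+ signed b r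
signed-linear false c m r = refl
signed-linear true = neg-linear
  where
    neg-linear : ∀ c m r → - (c ℚ.* m ℚ.+ r) ≡ c ℚ.* (- m) ℚ.+ (- r)
    neg-linear = RingSolver.solve-∀ ℚ-ring

signed-bound : ∀ b q {ε} → ∣ q ℚ.- toℚ b ∣ ℚ.≤ ε → signed b q ℚ.+ toℚ b ℚ.≤ ε
signed-bound false q close = ℚ.≤-trans (p≤∣p∣ (q ℚ.- 0ℚ)) close
signed-bound true q {ε} close = begin
  - q ℚ.+ 1ℚ        ≡⟨ negate-difference q ⟩
  - (q ℚ.- 1ℚ)      ≤⟨ p≤∣p∣ _ ⟩
  ∣ - (q ℚ.- 1ℚ) ∣  ≡⟨ ℚ.∣-p∣≡∣p∣ _ ⟩
  ∣ q ℚ.- 1ℚ ∣      ≤⟨ close ⟩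
  ε                 ∎
  where
    open ℚ.≤-Reasoning
    negate-difference : ∀ q → - q ℚ.+ 1ℚ ≡ - (q ℚ.- 1ℚ)
    negate-difference = RingSolver.solve-∀ ℚ-ring

opposite-bounds⇒negative-sum : ∀ a a′ t t′ {ε} → t ℚ.+ t′ ≡ 1ℚ → ε ℚ.< ½ →
  a ℚ.+ t ℚ.≤ ε → a′ ℚ.+ t′ ℚ.≤ ε → a ℚ.+ a′ ℚ.< 0ℚ
opposite-bounds⇒negative-sum a a′ t t′ {ε} t+t′≡1 ε<½ a+t≤ε a′+t′≤ε = begin-strict
  a ℚ.+ a′                                      ≡⟨ regroup a a′ t t′ ⟩
  (a ℚ.+ t) ℚ.+ (a′ ℚ.+ t′) ℚ.- (t ℚ.+ t′)       ≡⟨ cong (λ s → (a ℚ.+ t) ℚ.+ (a′ ℚ.+ t′) ℚ.- s) t+t′≡1 ⟩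
  (a ℚ.+ t) ℚ.+ (a′ ℚ.+ t′) ℚ.- 1ℚ              <⟨ ℚ.+-monoˡ-< (- 1ℚ) sum<1 ⟩
  ½ ℚ.+ ½ ℚ.- 1ℚ                                ≡⟨⟩
  0ℚ                                            ∎
  where
    open ℚ.≤-Reasoning
    sum<1 : (a ℚ.+ t) ℚ.+ (a′ ℚ.+ t′) ℚ.< ½ ℚ.+ ½
    sum<1 = ℚ.≤-<-trans (ℚ.+-mono-≤ a+t≤ε a′+t′≤ε) (ℚ.+-mono-< ε<½ ε<½)
    regroup : ∀ a a′ t t′ → a ℚ.+ a′ ≡ (a ℚ.+ t) ℚ.+ (a′ ℚ.+ t′) ℚ.- (t ℚ.+ t′)
    regroup = RingSolver.solve-∀ ℚ-ring

innerProducts : ∀ {n m} → Vec (Bits n) m → Bits n → Bits m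
innerProducts vs x = Vec.map (λ v → inner v x) vs

OddOrthogonal : ∀ {n m} → Vec (Bits n) m → Bits m → Set
OddOrthogonal vs S = ∃ λ z → Orthogonal S vs z × parity z ≡ true

monomial-periodic : ∀ {n m} (S : Bits m) (vs : Vec (Bits n) m) {z} → Orthogonal S vs z → ∀ x →
  monomial S (innerProducts vs (x ⊕ z)) ≡ monomial S (innerProducts vs x)
monomial-periodic [] [] _ x = refl
monomial-periodic (true ∷ S) (v ∷ vs) {z} (vz , o) x =
  cong₂ (λ b q → toℚ b ℚ.* q)
    (trans (inner-⊕ʳ v x z) (trans (cong (inner v x xor_) vz) (xor-identityʳ (inner v x))))
    (monomial-periodic S vs o x)
monomial-periodic (false ∷ S) (v ∷ vs) o x = cong (1ℚ ℚ.*_) (monomial-periodic S vs o x)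

module _ where
  open ℚ∑

  correlation : ∀ {n} → (Bits n → ℚ) → ℚ
  correlation {n} f = ∑[ x ← bitStrings n ] signed (parity x) (f x)

  ∑-neg : ∀ {A : Set} (xs : List A) (f : A → ℚ) → ∑[ x ← xs ] (- f x) ≡ - ∑ xs f
  ∑-neg [] f = refl
  ∑-neg (x ∷ xs) f = trans (cong ((- f x) ℚ.+_) (∑-neg xs f)) (sym (ℚ.neg-distrib-+ (f x) (∑ xs f)))

  ∑-≤0 : ∀ {A : Set} (xs : List A) {f : A → ℚ} → (∀ x → f x ℚ.< 0ℚ) → ∑ xs f ℚ.≤ 0ℚ
  ∑-≤0 [] negative = ℚ.≤-refl
  ∑-≤0 (x ∷ xs) negative = ℚ.+-mono-≤ (ℚ.<⇒≤ (negative x)) (∑-≤0 xs negative)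

  ∑-<0 : ∀ {A : Set} {xs : List A} {y : A} {f : A → ℚ} → y ∈ xs → (∀ x → f x ℚ.< 0ℚ) → ∑ xs f ℚ.< 0ℚ
  ∑-<0 {xs = x ∷ xs} (here refl) negative = ℚ.+-mono-<-≤ (negative x) (∑-≤0 xs negative)
  ∑-<0 {xs = x ∷ xs} (there y∈xs) negative = ℚ.+-mono-≤-< (ℚ.<⇒≤ (negative x)) (∑-<0 y∈xs negative)

  correlation-periodic : ∀ {n} (f : Bits n → ℚ) {z} → parity z ≡ true → (∀ x → f (x ⊕ z) ≡ f x) →
    correlation f ≡ 0ℚ
  correlation-periodic {n} f {z} odd periodic = p≡-p⇒p≡0 _ (begin
    correlation f                    ≡⟨ bitStrings-translationInvariant n g z ⟨
    ∑[ x ← bitStrings n ] g (x ⊕ z)  ≡⟨ ∑-cong (bitStrings n) g-flips ⟩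
    ∑[ x ← bitStrings n ] (- g x)    ≡⟨ ∑-neg (bitStrings n) g ⟩
    - correlation f                  ∎)
    where
      open ≡-Reasoning
      g : Bits n → ℚ
      g x = signed (parity x) (f x)
      g-flips : ∀ x → g (x ⊕ z) ≡ - g x
      g-flips x = begin
        signed (parity (x ⊕ z)) (f (x ⊕ z))
          ≡⟨ cong₂ signed (trans (parity-⊕ x z) (cong (parity x xor_) odd)) (periodic x) ⟩
        signed (parity x xor true) (f x)
          ≡⟨ cong (λ b → signed b (f x)) (xor-comm (parity x) true) ⟩
        signed (not (parity x)) (f x)
          ≡⟨ signed-not (parity x) (f x) ⟩
        - g x ∎

  correlation-linear : ∀ {n} (c : ℚ) (g h : Bits n → ℚ) →
    correlation (λ x → c ℚ.* g x ℚ.+ h x) ≡ c ℚ.* correlation g ℚ.+ correlation h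
  correlation-linear {n} c g h = begin
    correlation (λ x → c ℚ.* g x ℚ.+ h x)
      ≡⟨ ∑-cong (bitStrings n) (λ x → signed-linear (parity x) c (g x) (h x)) ⟩
    ∑[ x ← bitStrings n ] (c ℚ.* signed (parity x) (g x) ℚ.+ signed (parity x) (h x))
      ≡⟨ ∑-+ (bitStrings n) _ _ ⟩
    (∑[ x ← bitStrings n ] (c ℚ.* signed (parity x) (g x))) ℚ.+ correlation h
      ≡⟨ cong (ℚ._+ correlation h) (∑-*ˡ c (bitStrings n) _) ⟩
    c ℚ.* correlation g ℚ.+ correlation h ∎
    where open ≡-Reasoning

  correlation-eval : ∀ {n m} (vs : Vec (Bits n) m) (p : Poly m) → All (OddOrthogonal vs ∘ proj₂) p →
    correlation (λ x → eval p (innerProducts vs x)) ≡ 0ℚ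
  correlation-eval {n} vs [] [] = trans (∑-cong (bitStrings n) (λ x → signed-0 (parity x))) (∑-0 (bitStrings n))
    where
      signed-0 : ∀ b → signed b 0ℚ ≡ 0ℚ
      signed-0 false = refl
      signed-0 true = refl
  correlation-eval vs ((c , S) ∷ p) ((z , o , odd) ∷ odds) = begin
    correlation (λ x → c ℚ.* monomial S (innerProducts vs x) ℚ.+ eval p (innerProducts vs x))
      ≡⟨ correlation-linear c (λ x → monomial S (innerProducts vs x)) (λ x → eval p (innerProducts vs x)) ⟩
    c ℚ.* correlation (λ x → monomial S (innerProducts vs x)) ℚ.+ correlation (λ x → eval p (innerProducts vs x))
      ≡⟨ cong₂ (λ a b → c ℚ.* a ℚ.+ b) (correlation-periodic _ odd (monomial-periodic S vs o))
                                      (correlation-eval vs p odds) ⟩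
    c ℚ.* 0ℚ ℚ.+ 0ℚ                 ≡⟨ ℚ.+-identityʳ _ ⟩
    c ℚ.* 0ℚ                        ≡⟨ ℚ.*-zeroʳ c ⟩
    0ℚ                              ∎
    where open ≡-Reasoning

  -- Pairing x with x ⊕ e (e = 10…0 flips the parity) writes twice the correlation as a sum of
  -- negative terms.
  approximation-correlated : ∀ {n} (q : Bits (suc n) → ℚ) {ε} → ε ℚ.< ½ →
    (∀ x → ∣ q x ℚ.- toℚ (parity x) ∣ ℚ.≤ ε) → correlation q ≢ 0ℚ
  approximation-correlated {n} q {ε} ε<½ close correlation≡0 = ℚ.<-irrefl refl (begin-strict
    0ℚ
      ≡⟨ cong₂ ℚ._+_ correlation≡0 (trans (bitStrings-translationInvariant (suc n) g e) correlation≡0) ⟨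
    correlation q ℚ.+ (∑[ x ← bitStrings (suc n) ] g (x ⊕ e))
      ≡⟨ ∑-+ (bitStrings (suc n)) g (λ x → g (x ⊕ e)) ⟨
    ∑[ x ← bitStrings (suc n) ] (g x ℚ.+ g (x ⊕ e))
      <⟨ ∑-<0 (∈-bitStrings e) pair<0 ⟩
    0ℚ ∎)
    where
      open ℚ.≤-Reasoning
      e : Bits (suc n)
      e = true ∷ zeros
      g : Bits (suc n) → ℚ
      g x = signed (parity x) (q x)
      parity-flips : ∀ x → parity (x ⊕ e) ≡ not (parity x)
      parity-flips x = trans (parity-⊕ x e)
        (trans (cong (λ b → parity x xor not b) (parity-zeros n)) (xor-comm (parity x) true))
      toℚ-not : ∀ b → toℚ b ℚ.+ toℚ (not b) ≡ 1ℚ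
      toℚ-not false = refl
      toℚ-not true = refl
      pair<0 : ∀ x → g x ℚ.+ g (x ⊕ e) ℚ.< 0ℚ
      pair<0 x = opposite-bounds⇒negative-sum (g x) (g (x ⊕ e)) (toℚ (parity x)) (toℚ (parity (x ⊕ e)))
        (trans (cong (λ b → toℚ (parity x) ℚ.+ toℚ b) (parity-flips x)) (toℚ-not (parity x)))
        ε<½ (signed-bound (parity x) (q x) (close x)) (signed-bound (parity (x ⊕ e)) (q (x ⊕ e)) (close (x ⊕ e)))

parity-inapproximable : ∀ {n m} (vs : Vec (Bits (suc n)) m) {ε} → ε ℚ.< ½ →
  (p : Poly m) → All (OddOrthogonal vs ∘ proj₂) p →
  ∃ λ x → ε ℚ.< ∣ eval p (innerProducts vs x) ℚ.- toℚ (parity x) ∣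
parity-inapproximable {n} vs {ε} ε<½ p odds
  with any? (λ x → ε ℚ.<? ∣ eval p (innerProducts vs x) ℚ.- toℚ (parity x) ∣) (bitStrings (suc n))
... | yes far = satisfied far
... | no ¬far = ⊥-elim (approximation-correlated _ ε<½
  (λ x → ℚ.≮⇒≥ (All.lookup (¬Any⇒All¬ _ ¬far) (∈-bitStrings x))) (correlation-eval vs p odds))

-- Bad bases

Admissible : ℕ → ∀ {m} → Bits m → Set
Admissible n {m} T = m ^ (4 * suc (popcount T)) ≤ 2 ^ n

admissible? : ∀ n {m} → Decidable (Admissible n {m})
admissible? n {m} T = m ^ (4 * suc (popcount T)) ℕ.≤? 2 ^ n

admissible-anti : ∀ n {m} .{{_ : NonZero m}} {S T : Bits m} → popcount T ≤ popcount S →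
  Admissible n S → Admissible n T
admissible-anti n {m} T≤S S-admissible = ℕ.≤-trans (ℕ.^-monoʳ-≤ m (ℕ.*-monoʳ-≤ 4 (s≤s T≤S))) S-admissible

rows : ∀ {n m'} → Vec (Bits n) m' → Vec (Bits n) (n + m')
rows rs = tabulate unit ++ rs

RepresentsOnes : ∀ {n m'} → Vec (Bits n) m' → Bits (n + m') → Set
RepresentsOnes {n} rs T = Admissible n T × combination T (rows rs) ≡ ones

representsOnes? : ∀ {n m'} (rs : Vec (Bits n) m') → Decidable (RepresentsOnes rs)
representsOnes? {n} rs T = admissible? n T ×-dec (combination T (rows rs) ≟ ones)

Bad : ∀ {n m'} → Vec (Bits n) m' → Set
Bad {n} {m'} rs = Any (RepresentsOnes rs) (bitStrings (n + m'))

bad? : ∀ {n m'} → Decidable (Bad {n} {m'})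
bad? {n} {m'} rs = any? (representsOnes? rs) (bitStrings (n + m'))

¬bad⇒event : ∀ {n m'} (rs : Vec (Bits (suc n)) m') → ¬ Bad rs → Event rs
¬bad⇒event {n} rs ¬bad ε ε<½ p low-degree =
  parity-inapproximable (rows rs) ε<½ p (All.map (λ { {_ , S} → oddOrthogonal S }) low-degree)
  where
    oddOrthogonal : ∀ S → Admissible (suc n) S → OddOrthogonal (rows rs) S
    oddOrthogonal S S-admissible with combination-or-separated S (rows rs) ones
    ... | inj₁ (T , T≤S , T↦ones) =
      ⊥-elim (¬bad (lose (∈-bitStrings T) (admissible-anti (suc n) {S = S} {T} T≤S S-admissible , T↦ones)))
    ... | inj₂ (z , o , ones·z) = z , o , trans (sym (inner-onesˡ z)) ones·z

represents-ones⇔ : ∀ {n m'} (U : Bits n) (F : Bits m') (rs : Vec (Bits n) m') →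
  (combination (U ++ F) (rows rs) ≡ ones) ⇔ (combination F rs ≡ ∁ U)
represents-ones⇔ U F rs =
  subst₂ (λ l r → (l ≡ ones) ⇔ (combination F rs ≡ r)) (sym decomposition) (ones-⊕ U) ⊕-move
  where
    decomposition : combination (U ++ F) (rows rs) ≡ combination F rs ⊕ U
    decomposition = trans (combination-++ U F (tabulate unit) rs)
                          (trans (cong (_⊕ combination F rs) (combination-units U)) (⊕.comm U _))

popcount-++ : ∀ {k l} (A : Bits k) (B : Bits l) → popcount A ≤ popcount (A ++ B)
popcount-++ [] B = z≤n
popcount-++ (true ∷ A) B = s≤s (popcount-++ A B)
popcount-++ (false ∷ A) B = popcount-++ A B

inTemplate-⊕ : ∀ {n} (τ v d : Bits n) → T (inTemplateᵇ τ d) → inTemplateᵇ τ (v ⊕ d) ≡ inTemplateᵇ τ v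
inTemplate-⊕ [] [] [] _ = refl
inTemplate-⊕ (true ∷ τ) (x ∷ v) (b ∷ d) d∈τ = inTemplate-⊕ τ v d d∈τ
inTemplate-⊕ (false ∷ τ) (x ∷ v) (false ∷ d) d∈τ =
  cong₂ (λ a c → not a ∧ c) (xor-identityʳ x) (inTemplate-⊕ τ v d d∈τ)
inTemplate-⊕ (false ∷ τ) (x ∷ v) (true ∷ d) ()

inTemplate-∩ : ∀ {n} (τ v b : Bits n) → T (inTemplateᵇ τ v) → T (inTemplateᵇ τ (v ∩ b))
inTemplate-∩ [] [] [] _ = tt
inTemplate-∩ (true ∷ τ) (x ∷ v) (c ∷ b) v∈τ = inTemplate-∩ τ v b v∈τ
inTemplate-∩ (false ∷ τ) (false ∷ v) (c ∷ b) v∈τ = inTemplate-∩ τ v b v∈τ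
inTemplate-∩ (false ∷ τ) (true ∷ v) (c ∷ b) ()

inBase-⊕ : ∀ {n m'} (τs rs δ : Vec (Bits n) m') → T (inBaseᵇ τs δ) →
  inBaseᵇ τs (zipWith _⊕_ rs δ) ≡ inBaseᵇ τs rs
inBase-⊕ [] [] [] _ = refl
inBase-⊕ (τ ∷ τs) (r ∷ rs) (d ∷ δ) δ∈base with Equivalence.to T-∧ δ∈base
... | d∈τ , δ∈rest = cong₂ _∧_ (inTemplate-⊕ τ r d d∈τ) (inBase-⊕ τs rs δ δ∈rest)

inBase-∩ : ∀ {n m'} (τs rs : Vec (Bits n) m') (b : Bits n) → T (inBaseᵇ τs rs) →
  T (inBaseᵇ τs (Vec.map (_∩ b) rs))
inBase-∩ [] [] b _ = tt
inBase-∩ (τ ∷ τs) (r ∷ rs) b rs∈base with Equivalence.to T-∧ rs∈base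
... | r∈τ , rs∈rest = Equivalence.from T-∧ (inTemplate-∩ τ r b r∈τ , inBase-∩ τs rs b rs∈rest)

indicator : Bool → ℕ
indicator true = 1
indicator false = 0

module _ where
  open ℕ∑

  ∑-mono-≤ : ∀ {A : Set} (xs : List A) {f g : A → ℕ} → (∀ x → f x ≤ g x) → ∑ xs f ≤ ∑ xs g
  ∑-mono-≤ [] f≤g = ℕ.≤-refl
  ∑-mono-≤ (x ∷ xs) f≤g = ℕ.+-mono-≤ (f≤g x) (∑-mono-≤ xs f≤g)

  ∑-*ʳ : ∀ {A : Set} (c : ℕ) (xs : List A) (f : A → ℕ) → ∑[ x ← xs ] (f x * c) ≡ ∑ xs f * c
  ∑-*ʳ c xs f = trans (∑-cong xs (λ x → ℕ.*-comm (f x) c)) (trans (∑-*ˡ c xs f) (ℕ.*-comm c _))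

  ∑-const : ∀ n (c : ℕ) → ∑[ x ← bitStrings n ] c ≡ 2 ^ n * c
  ∑-const zero c = refl
  ∑-const (suc n) c = begin
    ∑[ x ← bitStrings (suc n) ] c                                ≡⟨ ∑-allVecs-suc bools n (λ _ → c) ⟩
    (∑[ x ← bitStrings n ] c) + ((∑[ x ← bitStrings n ] c) + 0)  ≡⟨ cong (λ s → s + (s + 0)) (∑-const n c) ⟩
    2 ^ n * c + (2 ^ n * c + 0)                                  ≡⟨ double (2 ^ n) c ⟩
    2 ^ suc n * c                                                ∎
    where
      open ≡-Reasoning
      double : ∀ p c → p * c + (p * c + 0) ≡ 2 * p * c
      double = solve-∀

  ∑-indicator-∧ : ∀ {A : Set} b (xs : List A) (f : A → Bool) →
    ∑[ x ← xs ] indicator (b ∧ f x) ≡ (if b then ∑[ x ← xs ] indicator (f x) else 0)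
  ∑-indicator-∧ true xs f = refl
  ∑-indicator-∧ false xs f = ∑-0 xs

  ∑-indicator≡0⊎witness : ∀ {A : Set} {P : A → Set} (P? : Decidable P) (xs : List A) →
    ∑[ x ← xs ] indicator (does (P? x)) ≡ 0 ⊎ ∃ P
  ∑-indicator≡0⊎witness P? [] = inj₁ refl
  ∑-indicator≡0⊎witness P? (x ∷ xs) with P? x
  ... | yes px = inj₂ (x , px)
  ... | no _ = ∑-indicator≡0⊎witness P? xs

  indicator-∧-any : ∀ {A : Set} {P : A → Set} b (P? : Decidable P) (xs : List A) →
    indicator (b ∧ does (any? P? xs)) ≤ ∑[ x ← xs ] indicator (b ∧ does (P? x))
  indicator-∧-any false P? xs = z≤n
  indicator-∧-any true P? [] = z≤n
  indicator-∧-any true P? (x ∷ xs) with does (P? x)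
  ... | true = s≤s z≤n
  ... | false = indicator-∧-any true P? xs

  length-filter : ∀ {A : Set} {P : A → Set} (P? : Decidable P) (xs : List A) →
    length (filter P? xs) ≡ ∑[ x ← xs ] indicator (does (P? x))
  length-filter P? [] = refl
  length-filter P? (x ∷ xs) with does (P? x)
  ... | true = cong suc (length-filter P? xs)
  ... | false = length-filter P? xs

  ∑-filter : ∀ {A : Set} {P : A → Set} (P? : Decidable P) (xs : List A) (f : A → ℕ) →
    ∑ (filter P? xs) f ≡ ∑[ x ← xs ] (if does (P? x) then f x else 0)
  ∑-filter P? [] f = refl
  ∑-filter P? (x ∷ xs) f with does (P? x)
  ... | true = cong (f x +_) (∑-filter P? xs f)
  ... | false = ∑-filter P? xs f

  length-filter-filter : ∀ {A : Set} {P Q : A → Set} (P? : Decidable P) (Q? : Decidable Q) (xs : List A) →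
    length (filter Q? (filter P? xs)) ≡ ∑[ x ← xs ] indicator (does (P? x) ∧ does (Q? x))
  length-filter-filter P? Q? xs = trans (length-filter Q? (filter P? xs))
    (trans (∑-filter P? xs _) (∑-cong xs (λ x → if-indicator (does (P? x)))))
    where
      if-indicator : ∀ b {c} → (if b then indicator c else 0) ≡ indicator (b ∧ c)
      if-indicator true = refl
      if-indicator false = refl

  ∑-masks : ∀ {n} (U y : Bits n) → ∑[ a ← bitStrings n ] indicator (does (y ≟ ∁ U ∩ a)) ≤ 2 ^ popcount U
  ∑-masks [] [] = ℕ.≤-refl
  ∑-masks {suc n} (u ∷ U) (b ∷ y) = begin
    ∑[ a ← bitStrings (suc n) ] indicator (does (b ∷ y ≟ ∁ (u ∷ U) ∩ a))
      ≡⟨ ∑-allVecs-suc bools n _ ⟩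
    ∑[ a ← bools ] ∑[ as ← bitStrings n ] indicator (does (b Bool.≟ not u ∧ a) ∧ does (y ≟ ∁ U ∩ as))
      ≡⟨ ∑-cong bools (λ a → ∑-indicator-∧ (does (b Bool.≟ not u ∧ a)) (bitStrings n) (λ as → does (y ≟ ∁ U ∩ as))) ⟩
    ∑[ a ← bools ] (if does (b Bool.≟ not u ∧ a) then S else 0)
      ≤⟨ bound u b ⟩
    2 ^ popcount (u ∷ U) ∎
    where
      open ℕ.≤-Reasoning
      S : ℕ
      S = ∑[ a ← bitStrings n ] indicator (does (y ≟ ∁ U ∩ a))
      S≤ : S ≤ 2 ^ popcount U
      S≤ = ∑-masks U y
      S+0≤ : S + 0 ≤ 2 ^ popcount U
      S+0≤ = ℕ.≤-trans (ℕ.≤-reflexive (ℕ.+-identityʳ S)) S≤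
      bound : ∀ u b → ∑[ a ← bools ] (if does (b Bool.≟ not u ∧ a) then S else 0) ≤ 2 ^ popcount (u ∷ U)
      bound true true = z≤n
      bound true false = ℕ.+-mono-≤ S≤ (ℕ.+-mono-≤ S≤ z≤n)
      bound false true = S+0≤
      bound false false = S+0≤

-- The admissible mass

[2+a]^j*b≤a^[1+j] : ∀ a j b → b + 2 * j ≡ a → (2 + a) ^ j * b ≤ a ^ suc j
[2+a]^j*b≤a^[1+j] a zero b b+0≡a = ℕ.≤-reflexive (begin
  1 * b  ≡⟨ ℕ.*-identityˡ b ⟩
  b      ≡⟨ ℕ.+-identityʳ b ⟨
  b + 0  ≡⟨ b+0≡a ⟩
  a      ≡⟨ ℕ.*-identityʳ a ⟨
  a * 1  ∎)
  where open ≡-Reasoning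
[2+a]^j*b≤a^[1+j] a (suc j) b b+2[1+j]≡a = begin
  (2 + a) ^ suc j * b          ≡⟨ regroup (2 + a) ((2 + a) ^ j) b ⟩
  (2 + a) ^ j * ((2 + a) * b)  ≤⟨ ℕ.*-monoʳ-≤ ((2 + a) ^ j) step ⟩
  (2 + a) ^ j * (a * (b + 2))  ≡⟨ regroup′ ((2 + a) ^ j) a (b + 2) ⟩
  a * ((2 + a) ^ j * (b + 2))  ≤⟨ ℕ.*-monoʳ-≤ a ([2+a]^j*b≤a^[1+j] a j (b + 2) (trans (shift b j) b+2[1+j]≡a)) ⟩
  a * a ^ suc j                ∎
  where
    open ℕ.≤-Reasoning
    regroup : ∀ x y z → x * y * z ≡ y * (x * z)
    regroup = solve-∀
    regroup′ : ∀ x y z → x * (y * z) ≡ y * (x * z)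
    regroup′ = solve-∀
    shift : ∀ b j → b + 2 + 2 * j ≡ b + 2 * suc j
    shift = solve-∀
    expand : ∀ a b → (2 + a) * b ≡ a * b + 2 * b
    expand = solve-∀
    factor : ∀ a b → a * b + 2 * a ≡ a * (b + 2)
    factor = solve-∀
    b≤a : b ≤ a
    b≤a = ℕ.≤-trans (ℕ.m≤m+n b (2 * suc j)) (ℕ.≤-reflexive b+2[1+j]≡a)
    step : (2 + a) * b ≤ a * (b + 2)
    step = begin
      (2 + a) * b    ≡⟨ expand a b ⟩
      a * b + 2 * b  ≤⟨ ℕ.+-monoʳ-≤ (a * b) (ℕ.*-monoʳ-≤ 2 b≤a) ⟩
      a * b + 2 * a  ≡⟨ factor a b ⟩
      a * (b + 2)    ∎

2M+3≤M^4 : ∀ M → 2 ≤ M → 2 * M + 3 ≤ M ^ 4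
2M+3≤M^4 M 2≤M = begin
  2 * M + 3      ≤⟨ ℕ.+-monoʳ-≤ (2 * M) (ℕ.≤-trans (s≤s (s≤s (s≤s z≤n))) (ℕ.*-monoʳ-≤ 6 2≤M)) ⟩
  2 * M + 6 * M  ≡⟨ collect M ⟩
  8 * M          ≤⟨ ℕ.*-monoˡ-≤ M (ℕ.^-monoˡ-≤ 3 2≤M) ⟩
  M ^ 3 * M      ≡⟨ ℕ.*-comm (M ^ 3) M ⟩
  M ^ 4          ∎
  where
    open ℕ.≤-Reasoning
    collect : ∀ M → 2 * M + 6 * M ≡ 8 * M
    collect = solve-∀

3*[2+M⁴]^M≤[M⁴]^[1+M] : ∀ M → 2 ≤ M → 3 * (2 + M ^ 4) ^ M ≤ (M ^ 4) ^ suc M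
3*[2+M⁴]^M≤[M⁴]^[1+M] M 2≤M with ℕ.m≤n⇒∃[o]m+o≡n (2M+3≤M^4 M 2≤M)
... | k , 2M+3+k≡M⁴ = begin
  3 * (2 + M ^ 4) ^ M        ≡⟨ ℕ.*-comm 3 ((2 + M ^ 4) ^ M) ⟩
  (2 + M ^ 4) ^ M * 3        ≤⟨ ℕ.*-monoʳ-≤ ((2 + M ^ 4) ^ M) (ℕ.m≤m+n 3 k) ⟩
  (2 + M ^ 4) ^ M * (3 + k)  ≤⟨ [2+a]^j*b≤a^[1+j] (M ^ 4) M (3 + k) (trans (reorder k M) 2M+3+k≡M⁴) ⟩
  (M ^ 4) ^ suc M            ∎
  where
    open ℕ.≤-Reasoning
    reorder : ∀ k M → 3 + k + 2 * M ≡ 2 * M + 3 + k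
    reorder = solve-∀

weight : ℕ → ∀ {k} → Bits k → ℕ
weight a [] = 1
weight a (true ∷ T) = 2 * weight a T
weight a (false ∷ T) = a * weight a T

weight-*-pow : ∀ a {k} (T : Bits k) → weight a T * a ^ popcount T ≡ 2 ^ popcount T * a ^ k
weight-*-pow a [] = refl
weight-*-pow a {suc k} (true ∷ T) = begin
  2 * weight a T * (a * a ^ popcount T)  ≡⟨ regroup 2 (weight a T) a (a ^ popcount T) ⟩
  2 * a * (weight a T * a ^ popcount T)  ≡⟨ cong (2 * a *_) (weight-*-pow a T) ⟩
  2 * a * (2 ^ popcount T * a ^ k)       ≡⟨ regroup 2 a (2 ^ popcount T) (a ^ k) ⟩
  2 * 2 ^ popcount T * (a * a ^ k)       ∎
  where
    open ≡-Reasoning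
    regroup : ∀ x y z w → x * y * (z * w) ≡ x * z * (y * w)
    regroup = solve-∀
weight-*-pow a {suc k} (false ∷ T) = begin
  a * weight a T * a ^ popcount T    ≡⟨ ℕ.*-assoc a (weight a T) _ ⟩
  a * (weight a T * a ^ popcount T)  ≡⟨ cong (a *_) (weight-*-pow a T) ⟩
  a * (2 ^ popcount T * a ^ k)       ≡⟨ regroup a (2 ^ popcount T) (a ^ k) ⟩
  2 ^ popcount T * (a * a ^ k)       ∎
  where
    open ≡-Reasoning
    regroup : ∀ x y z → x * (y * z) ≡ y * (x * z)
    regroup = solve-∀

admissible-weight : ∀ n {M} (T : Bits M) → Admissible n T →
  (M ^ 4) ^ suc M * 2 ^ popcount T ≤ weight (M ^ 4) T * 2 ^ n
admissible-weight n {M} T T-admissible = begin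
  a * a ^ M * 2 ^ p             ≡⟨ regroup a (a ^ M) (2 ^ p) ⟩
  a * (2 ^ p * a ^ M)           ≡⟨ cong (a *_) (weight-*-pow a T) ⟨
  a * (weight a T * a ^ p)      ≡⟨ regroup′ a (weight a T) (a ^ p) ⟩
  weight a T * (a * a ^ p)      ≡⟨ cong (weight a T *_) (ℕ.^-*-assoc M 4 (suc p)) ⟩
  weight a T * M ^ (4 * suc p)  ≤⟨ ℕ.*-monoʳ-≤ (weight a T) T-admissible ⟩
  weight a T * 2 ^ n            ∎
  where
    open ℕ.≤-Reasoning
    a = M ^ 4
    p = popcount T
    regroup : ∀ x y z → x * y * z ≡ x * (z * y)
    regroup = solve-∀
    regroup′ : ∀ x y z → x * (y * z) ≡ y * (x * z)
    regroup′ = solve-∀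

admissibleMass : ℕ → ℕ → ℕ
admissibleMass n M = ℕ∑.∑ (bitStrings M) (λ T → indicator (does (admissible? n T)) * 2 ^ popcount T)

module _ where
  open ℕ∑

  ∑-weight : ∀ a k → ∑[ T ← bitStrings k ] weight a T ≡ (2 + a) ^ k
  ∑-weight a zero = refl
  ∑-weight a (suc k) = begin
    ∑[ T ← bitStrings (suc k) ] weight a T
      ≡⟨ ∑-allVecs-suc bools k (weight a) ⟩
    (∑[ T ← bitStrings k ] (2 * weight a T)) + ((∑[ T ← bitStrings k ] (a * weight a T)) + 0)
      ≡⟨ cong₂ (λ x y → x + (y + 0)) (∑-*ˡ 2 (bitStrings k) (weight a)) (∑-*ˡ a (bitStrings k) (weight a)) ⟩
    2 * W + (a * W + 0)
      ≡⟨ cong (λ w → 2 * w + (a * w + 0)) (∑-weight a k) ⟩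
    2 * (2 + a) ^ k + (a * (2 + a) ^ k + 0)
      ≡⟨ collect a ((2 + a) ^ k) ⟩
    (2 + a) ^ suc k ∎
    where
      open ≡-Reasoning
      W = ∑[ T ← bitStrings k ] weight a T
      collect : ∀ a w → 2 * w + (a * w + 0) ≡ (2 + a) * w
      collect = solve-∀

  admissibleMass-bound : ∀ n M → 2 ≤ M → 3 * admissibleMass n M ≤ 2 ^ n
  admissibleMass-bound n M 2≤M = ℕ.*-cancelˡ-≤ A (begin
    A * (3 * admissibleMass n M)
      ≡⟨ regroup A 3 (admissibleMass n M) ⟩
    3 * (A * admissibleMass n M)
      ≡⟨ cong (3 *_) (∑-*ˡ A (bitStrings M) _) ⟨
    3 * (∑[ T ← bitStrings M ] (A * (indicator (does (admissible? n T)) * 2 ^ popcount T)))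
      ≤⟨ ℕ.*-monoʳ-≤ 3 (∑-mono-≤ (bitStrings M) per-T) ⟩
    3 * (∑[ T ← bitStrings M ] (weight (M ^ 4) T * 2 ^ n))
      ≡⟨ cong (3 *_) (trans (∑-*ʳ (2 ^ n) (bitStrings M) (weight (M ^ 4))) (cong (_* 2 ^ n) (∑-weight (M ^ 4) M))) ⟩
    3 * ((2 + M ^ 4) ^ M * 2 ^ n)
      ≡⟨ ℕ.*-assoc 3 ((2 + M ^ 4) ^ M) (2 ^ n) ⟨
    3 * (2 + M ^ 4) ^ M * 2 ^ n
      ≤⟨ ℕ.*-monoˡ-≤ (2 ^ n) (3*[2+M⁴]^M≤[M⁴]^[1+M] M 2≤M) ⟩
    A * 2 ^ n ∎)
    where
      open ℕ.≤-Reasoning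
      A = (M ^ 4) ^ suc M
      instance
        A≢0 : NonZero A
        A≢0 = ℕ.m^n≢0 (M ^ 4) (suc M) {{ℕ.m^n≢0 M 4 {{>-nonZero (ℕ.≤-trans (s≤s z≤n) 2≤M)}}}}
      regroup : ∀ x y z → x * (y * z) ≡ y * (x * z)
      regroup = solve-∀
      per-T : ∀ T → A * (indicator (does (admissible? n T)) * 2 ^ popcount T) ≤ weight (M ^ 4) T * 2 ^ n
      per-T T = by-cases (admissible? n T)
        where
          by-cases : (T? : Dec (Admissible n T)) →
            A * (indicator (does T?) * 2 ^ popcount T) ≤ weight (M ^ 4) T * 2 ^ n
          by-cases (yes T-admissible) =
            ℕ.≤-trans (ℕ.≤-reflexive (cong (A *_) (ℕ.*-identityˡ _))) (admissible-weight n T T-admissible)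
          by-cases (no _) = ℕ.≤-trans (ℕ.≤-reflexive (ℕ.*-zeroʳ A)) z≤n

-- Probability of a bad base

module Counting {n m' : ℕ} (τs : Vec (Bits n) m') where
  open ℕ∑

  inBase : Vec (Bits n) m' → Bool
  inBase = inBaseᵇ τs

  #base : ℕ
  #base = ∑[ rs ← tuples n m' ] indicator (inBase rs)

  #[_] : {P : Vec (Bits n) m' → Set} → Decidable P → ℕ
  #[ P? ] = ∑[ rs ← tuples n m' ] indicator (inBase rs ∧ does (P? rs))

  fibre : Bits m' → Bits n → ℕ
  fibre F c = #[ (λ rs → combination F rs ≟ c) ]

  fibre-translate : ∀ F c δ → T (inBase δ) → fibre F c ≡ fibre F (c ⊕ combination F δ)
  fibre-translate F c δ δ∈base = begin
    fibre F c
      ≡⟨ allVecs-translationInvariant (bitStrings-translationInvariant n) m' _ δ ⟨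
    ∑[ rs ← tuples n m' ] indicator (inBase (zipWith _⊕_ rs δ) ∧ does (combination F (zipWith _⊕_ rs δ) ≟ c))
      ≡⟨ ∑-cong (tuples n m') (λ rs → cong₂ (λ b d → indicator (b ∧ d))
           (inBase-⊕ τs rs δ δ∈base) (does-⇔ (shift rs) (_ ≟ c) (_ ≟ c ⊕ combination F δ))) ⟩
    fibre F (c ⊕ combination F δ) ∎
    where
      open ≡-Reasoning
      shift : ∀ rs → (combination F (zipWith _⊕_ rs δ) ≡ c) ⇔ (combination F rs ≡ c ⊕ combination F δ)
      shift rs = subst (λ u → (u ≡ c) ⇔ (combination F rs ≡ c ⊕ combination F δ))
                       (sym (combination-⊕ F rs δ)) ⊕-move

  fibre-∩ : ∀ F {rs₀} → T (inBase rs₀) → ∀ a → fibre F (combination F rs₀) ≡ fibre F (combination F rs₀ ∩ a)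
  fibre-∩ F {rs₀} rs₀∈base a = trans
    (fibre-translate F c (Vec.map (_∩ ∁ a) rs₀) (inBase-∩ τs rs₀ (∁ a) rs₀∈base))
    (cong (fibre F) (trans (cong (c ⊕_) (combination-∩ F rs₀ (∁ a))) (⊕-∩-∁ c a)))
    where c = combination F rs₀

  fibre-bound : ∀ F U → 2 ^ n * fibre F (∁ U) ≤ 2 ^ popcount U * #base
  fibre-bound F U with ∑-indicator≡0⊎witness (λ rs → T? (inBase rs) ×-dec (combination F rs ≟ ∁ U)) (tuples n m')
  ... | inj₁ empty = ℕ.≤-trans (ℕ.≤-reflexive (trans (cong (2 ^ n *_) empty) (ℕ.*-zeroʳ (2 ^ n)))) z≤n
  ... | inj₂ (rs₀ , rs₀∈base , rs₀↦∁U) = begin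
    2 ^ n * fibre F (∁ U)
      ≡⟨ ∑-const n _ ⟨
    ∑[ a ← bitStrings n ] fibre F (∁ U)
      ≡⟨ ∑-cong (bitStrings n) (λ a → subst (λ c → fibre F c ≡ fibre F (c ∩ a)) rs₀↦∁U (fibre-∩ F rs₀∈base a)) ⟩
    ∑[ a ← bitStrings n ] fibre F (∁ U ∩ a)
      ≡⟨ ∑-comm (bitStrings n) (tuples n m') _ ⟩
    ∑[ rs ← tuples n m' ] ∑[ a ← bitStrings n ] indicator (inBase rs ∧ does (combination F rs ≟ ∁ U ∩ a))
      ≡⟨ ∑-cong (tuples n m') (λ rs → ∑-indicator-∧ (inBase rs) (bitStrings n) _) ⟩
    ∑[ rs ← tuples n m' ] (if inBase rs then ∑[ a ← bitStrings n ] indicator (does (combination F rs ≟ ∁ U ∩ a)) else 0)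
      ≤⟨ ∑-mono-≤ (tuples n m') (λ rs → masked (inBase rs) (∑-masks U (combination F rs))) ⟩
    ∑[ rs ← tuples n m' ] (2 ^ popcount U * indicator (inBase rs))
      ≡⟨ ∑-*ˡ (2 ^ popcount U) (tuples n m') _ ⟩
    2 ^ popcount U * #base ∎
    where
      open ℕ.≤-Reasoning
      masked : ∀ b {x c} → x ≤ c → (if b then x else 0) ≤ c * indicator b
      masked true {c = c} x≤c = ℕ.≤-trans x≤c (ℕ.≤-reflexive (sym (ℕ.*-identityʳ c)))
      masked false _ = z≤n

  ones-representations-bound : ∀ T → 2 ^ n * #[ (λ rs → combination T (rows rs) ≟ ones) ] ≤ 2 ^ popcount T * #base
  ones-representations-bound T with Vec.splitAt n T
  ... | U , F , refl = begin
    2 ^ n * #[ (λ rs → combination (U ++ F) (rows rs) ≟ ones) ]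
      ≡⟨ cong (2 ^ n *_) (∑-cong (tuples n m') (λ rs → cong (λ b → indicator (inBase rs ∧ b))
           (does-⇔ (represents-ones⇔ U F rs) (_ ≟ ones) (_ ≟ ∁ U)))) ⟩
    2 ^ n * fibre F (∁ U)          ≤⟨ fibre-bound F U ⟩
    2 ^ popcount U * #base         ≤⟨ ℕ.*-monoˡ-≤ #base (ℕ.^-monoʳ-≤ 2 (popcount-++ U F)) ⟩
    2 ^ popcount (U ++ F) * #base  ∎
    where open ℕ.≤-Reasoning

  representations : Bits (n + m') → ℕ
  representations T = #[ (λ rs → representsOnes? rs T) ]

  #bad≤∑representations : #[ bad? ] ≤ ∑[ T ← bitStrings (n + m') ] representations T
  #bad≤∑representations = begin
    #[ bad? ]
      ≤⟨ ∑-mono-≤ (tuples n m') (λ rs → indicator-∧-any (inBase rs) (representsOnes? rs) (bitStrings (n + m'))) ⟩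
    ∑[ rs ← tuples n m' ] ∑[ T ← bitStrings (n + m') ] indicator (inBase rs ∧ does (representsOnes? rs T))
      ≡⟨ ∑-comm (tuples n m') (bitStrings (n + m')) _ ⟩
    ∑[ T ← bitStrings (n + m') ] representations T ∎
    where open ℕ.≤-Reasoning

  representations-factorise : ∀ T →
    representations T ≡ indicator (does (admissible? n T)) * #[ (λ rs → combination T (rows rs) ≟ ones) ]
  representations-factorise T = trans
    (∑-cong (tuples n m') (λ rs → indicator-∧-∧ (inBase rs) (does (admissible? n T)) _))
    (∑-*ˡ (indicator (does (admissible? n T))) (tuples n m')
          (λ rs → indicator (inBase rs ∧ does (combination T (rows rs) ≟ ones))))
    where
      indicator-∧-∧ : ∀ b a c → indicator (b ∧ (a ∧ c)) ≡ indicator a * indicator (b ∧ c)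
      indicator-∧-∧ b true c = sym (ℕ.*-identityˡ _)
      indicator-∧-∧ true false c = refl
      indicator-∧-∧ false false c = refl

  bad-bound : 2 ^ n * #[ bad? ] ≤ admissibleMass n (n + m') * #base
  bad-bound = begin
    2 ^ n * #[ bad? ]
      ≤⟨ ℕ.*-monoʳ-≤ (2 ^ n) #bad≤∑representations ⟩
    2 ^ n * (∑[ T ← bitStrings (n + m') ] representations T)
      ≡⟨ ∑-*ˡ (2 ^ n) (bitStrings (n + m')) representations ⟨
    ∑[ T ← bitStrings (n + m') ] (2 ^ n * representations T)
      ≤⟨ ∑-mono-≤ (bitStrings (n + m')) per-T ⟩
    ∑[ T ← bitStrings (n + m') ] (indicator (does (admissible? n T)) * 2 ^ popcount T * #base)
      ≡⟨ ∑-*ʳ #base (bitStrings (n + m')) _ ⟩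
    admissibleMass n (n + m') * #base ∎
    where
      open ℕ.≤-Reasoning
      regroup : ∀ x y z → x * (y * z) ≡ y * (x * z)
      regroup = solve-∀
      per-T : ∀ T → 2 ^ n * representations T ≤ indicator (does (admissible? n T)) * 2 ^ popcount T * #base
      per-T T = let i = indicator (does (admissible? n T)) in begin
        2 ^ n * representations T
          ≡⟨ cong (2 ^ n *_) (representations-factorise T) ⟩
        2 ^ n * (i * #[ (λ rs → combination T (rows rs) ≟ ones) ])
          ≡⟨ regroup (2 ^ n) i _ ⟩
        i * (2 ^ n * #[ (λ rs → combination T (rows rs) ≟ ones) ])
          ≤⟨ ℕ.*-monoʳ-≤ i (ones-representations-bound T) ⟩
        i * (2 ^ popcount T * #base)
          ≡⟨ ℕ.*-assoc i (2 ^ popcount T) #base ⟨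
        i * 2 ^ popcount T * #base ∎

  #base≡#good+#bad : #base ≡ #[ ¬? ∘ bad? ] + #[ bad? ]
  #base≡#good+#bad = trans (∑-cong (tuples n m') (λ rs → split (inBase rs) (does (bad? rs)))) (∑-+ (tuples n m') _ _)
    where
      split : ∀ b c → indicator b ≡ indicator (b ∧ not c) + indicator (b ∧ c)
      split true true = refl
      split true false = refl
      split false c = refl

  3*#bad≤#base : 2 ≤ n + m' → 3 * #[ bad? ] ≤ #base
  3*#bad≤#base 2≤M = ℕ.*-cancelˡ-≤ (2 ^ n) {{ℕ.m^n≢0 2 n}} (begin
    2 ^ n * (3 * #[ bad? ])                  ≡⟨ regroup (2 ^ n) 3 #[ bad? ] ⟩
    3 * (2 ^ n * #[ bad? ])                  ≤⟨ ℕ.*-monoʳ-≤ 3 bad-bound ⟩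
    3 * (admissibleMass n (n + m') * #base)  ≡⟨ ℕ.*-assoc 3 (admissibleMass n (n + m')) #base ⟨
    3 * admissibleMass n (n + m') * #base    ≤⟨ ℕ.*-monoˡ-≤ #base (admissibleMass-bound n (n + m') 2≤M) ⟩
    2 ^ n * #base                            ∎)
    where
      open ℕ.≤-Reasoning
      regroup : ∀ x y z → x * (y * z) ≡ y * (x * z)
      regroup = solve-∀

2*b≤3*g : ∀ {b g d} → b ≡ g + d → 3 * d ≤ b → 2 * b ≤ 3 * g
2*b≤3*g {b} {g} {d} b≡g+d 3d≤b = ℕ.+-cancelʳ-≤ b (2 * b) (3 * g) (begin
  2 * b + b      ≡⟨ triple b ⟩
  3 * b          ≡⟨ cong (3 *_) b≡g+d ⟩
  3 * (g + d)    ≡⟨ ℕ.*-distribˡ-+ 3 g d ⟩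
  3 * g + 3 * d  ≤⟨ ℕ.+-monoʳ-≤ (3 * g) 3d≤b ⟩
  3 * g + b      ∎)
  where
    open ℕ.≤-Reasoning
    triple : ∀ b → 2 * b + b ≡ 3 * b
    triple = solve-∀

theorem3p4 : (n m' : ℕ) → 1 ≤ n → 2 ≤ n + m' → (τs : Vec (Bits n) m') →
    ProbAtLeastTwoThirds τs
theorem3p4 (suc n) m' _ 2≤M τs = good , good-unique , good-sound , good-large
  where
    open Counting τs
    base good : List (Vec (Bits (suc n)) m')
    base = filter (λ rs → T? (inBase rs)) (tuples (suc n) m')
    good = filter (¬? ∘ bad?) base
    good-unique : Unique good
    good-unique = Unique.filter⁺ _ (Unique.filter⁺ _ (allVecs-unique (allVecs-unique bools-unique (suc n)) m'))
    good-sound : All (λ rs → T (inBase rs) × Event rs) good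
    good-sound = All.zipWith (λ (rs∈base , ¬bad) → rs∈base , ¬bad⇒event _ ¬bad)
      (All.filter⁺ _ (all-filter _ (tuples (suc n) m')) , all-filter _ base)
    good-large : 2 * baseSize τs ≤ 3 * length good
    good-large = subst₂ (λ b g → 2 * b ≤ 3 * g)
      (sym (length-filter _ (tuples (suc n) m'))) (sym (length-filter-filter _ _ (tuples (suc n) m')))
      (2*b≤3*g {d = #[ bad? ]} #base≡#good+#bad (3*#bad≤#base 2≤M))
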